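{- In a two-parent hollow heap (as defined in the context) consisting of $N$ nodes (full and hollow), every node has rank at most $\log_\phi N$, where $\phi=(1+\sqrt5)/2$.
   Context: Heaps. A heap stores a finite set of items, each with a key from a totally ordered universe, and supports: make-heap() (return an empty heap); find-min($h$) (return an item of minimum key in $h$, or null if $h$ is empty); insert($e,k,h$) (add item $e$, which is in no heap, with key $k$); delete-min($h$) (delete from non-empty $h$ the item that find-min($h$) returns); meld($h_1,h_2$) (return a heap containing all items of the item-disjoint heaps $h_1,h_2$); decrease-key($e,k,h$) (given an item $e$ in $h$ with key greater than $k$, change its key to $k$); delete($e,h$) (delete item $e$ from $h$). Heaps passed as arguments are destroyed; decrease-key and delete are given the location of $e$. Nodes. Nodes hold items: each node holds at most one item, and is full if it holds one and hollow otherwise; each item in a heap is held by exactly one node; a newly created node is full and a hollow node never becomes full again. Each node $u$ has a key $u.key$ (the current key of its item if $u$ is full; if $u$ is hollow, the key its item had just before leaving $u$) and a non-negative integer rank $u.rank$. A tree (or dag) of nodes with arcs from parent to child is heap-ordered if $v.key\le w.key$ for every arc $(v,w)$; a root is a node with no parent. For two full roots, link makes the one of larger key (ties broken arbitrarily) a child of the other; the new child is the loser and the other the winner. A ranked link is a link of two roots of equal rank and increases the winner's rank by one; an unranked link may be applied to any two full roots and changes no ranks. Two-parent hollow heap. It is either empty or a heap-ordered directed acyclic graph of nodes with one root, which is full; the root is the minimum node. make-heap returns an empty heap; find-min returns the item in the root; meld returns one heap if the other is empty, and otherwise does an unranked link of the two roots; insert($e,k,h$) creates a new full node of rank 0 holding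 $e$ with key $k$ and melds this one-node heap with $h$. decrease-key($e,k,h$), with $u$ the node holding $e$: if $u$ is the root one may simply set $u.key=k$; otherwise create a new node $v$, move $e$ from $u$ to $v$ (so $u$ becomes hollow), set $v.key=k$ and $v.rank=\max\{0,u.rank-2\}$, add the arc $(v,u)$ so that $u$ acquires $v$ as an additional parent (no children of $u$ are moved), and meld the one-node heap $v$ with the heap. delete($e,h$) removes $e$ from the node $u$ holding it, making $u$ hollow; if $u$ is not the root this completes the operation; otherwise, while some root is hollow, destroy such a root (removing its outgoing arcs, so that children left with no parent become roots); then do ranked links while two roots have equal rank; then do unranked links until one root remains. delete-min($h$) performs delete on the item in the root. -}

module Defs where

open import Level using (_⊔_)
open import Data.Nat using (ℕ; zero; suc; _+_; _*_; _∸_; _≤_)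
open import Data.Nat.Properties using (_≟_)
open import Data.Bool using (Bool; true; false; if_then_else_)
open import Data.Product using (_×_; _,_; proj₁; proj₂; ∃; ∃-syntax)
open import Data.Sum using (_⊎_)
open import Data.List using (List; []; _∷_; _++_; map; filter; length)
open import Data.List.Relation.Unary.Any using (Any)
open import Data.List.Relation.Unary.All using (All)
open import Relation.Nullary using (¬_; does)
open import Relation.Nullary.Decidable using (¬?)
open import Relation.Binary.PropositionalEquality using (_≡_)
open import Relation.Binary.Bundles using (TotalOrder)
open import Relation.Binary.Construct.Closure.ReflexiveTransitive using (Star)

-- fib r and lucas r are the Fibonacci and Lucas numbers; one has
--   φ^r = (lucas r + fib r · √5) / 2 .

fib : ℕ → ℕ
fib 0 = 0
fib 1 = 1
fib (suc (suc n)) = fib (suc n) + fib n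

lucas : ℕ → ℕ
lucas 0 = 2
lucas 1 = 1
lucas (suc (suc n)) = lucas (suc n) + lucas n

-- a + b·√5 ≤ c   (a b c natural numbers), decided exactly:
--   a ≤ c  and  5·b² ≤ (c − a)²
Sqrt5Le : ℕ → ℕ → ℕ → Set
Sqrt5Le a b c = (a ≤ c) × (5 * (b * b) ≤ (c ∸ a) * (c ∸ a))

-- φ^r ≤ N,  i.e.  r ≤ log_φ N  (for N ≥ 1):
--   (lucas r + fib r · √5)/2 ≤ N  ⇔  lucas r + fib r · √5 ≤ 2N
PhiPow≤ : ℕ → ℕ → Set
PhiPow≤ r N = Sqrt5Le (lucas r) (fib r) (2 * N)

-- A heap (or, during a delete, an intermediate collection of dags) is
-- represented by a finite list of nodes, each with a unique identifier
-- (a natural number), and a list of arcs (parent-id , child-id).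
-- Items themselves play no role in the structure: a node is full iff it
-- holds an item.

module HollowHeap {c ℓ₁ ℓ₂} (O : TotalOrder c ℓ₁ ℓ₂) where

  open TotalOrder O renaming (Carrier to Key; _≤_ to _≤ₖ_)

  _<ₖ_ : Key → Key → Set ℓ₂
  a <ₖ b = (a ≤ₖ b) × ¬ (b ≤ₖ a)

  record Node : Set c where
    constructor mkNode
    field
      nid  : ℕ
      full : Bool
      key  : Key
      rank : ℕ
  open Node public

  record State : Set c where
    constructor ⟨_,_⟩
    field
      nodes : List Node
      arcs  : List (ℕ × ℕ)
  open State public

  emptyHeap : State
  emptyHeap = ⟨ [] , [] ⟩

  single : ℕ → Key → ℕ → State
  single x k r = ⟨ mkNode x true k r ∷ [] , [] ⟩

  IsNode : State → ℕ → Set c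
  IsNode s x = Any (λ n → nid n ≡ x) (nodes s)

  Fresh : State → ℕ → Set c
  Fresh s x = ¬ IsNode s x

  FullNode : State → ℕ → Key → ℕ → Set c
  FullNode s x k r = Any (λ n → mkNode x true k r ≡ n) (nodes s)

  HollowNode : State → ℕ → Set c
  HollowNode s x = Any (λ n → (nid n ≡ x) × (full n ≡ false)) (nodes s)

  HasParent : State → ℕ → Set
  HasParent s x = Any (λ a → proj₂ a ≡ x) (arcs s)

  IsRoot : State → ℕ → Set c
  IsRoot s x = IsNode s x × ¬ HasParent s x

  NoHollowRoot : State → Set c
  NoHollowRoot s = ∀ x → IsRoot s x → ¬ HollowNode s x

  DistinctRootRanks : State → Set c
  DistinctRootRanks s = ∀ x y kx ky r → IsRoot s x → IsRoot s y →
                        FullNode s x kx r → FullNode s y ky r → x ≡ y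

  AtMostOneRoot : State → Set c
  AtMostOneRoot s = ∀ x y → IsRoot s x → IsRoot s y → x ≡ y

  Disjoint : State → State → Set c
  Disjoint s t = ∀ x → IsNode s x → ¬ IsNode t x

  _∪_ : State → State → State
  s ∪ t = ⟨ nodes s ++ nodes t , arcs s ++ arcs t ⟩

  addArc : ℕ → ℕ → State → State
  addArc p q s = ⟨ nodes s , (p , q) ∷ arcs s ⟩

  makeHollow : ℕ → State → State
  makeHollow x s =
    ⟨ map (λ n → if does (nid n ≟ x) then mkNode (nid n) false (key n) (rank n) else n) (nodes s)
    , arcs s ⟩

  setKey : ℕ → Key → State → State
  setKey x k s =
    ⟨ map (λ n → if does (nid n ≟ x) then mkNode (nid n) (full n) k (rank n) else n) (nodes s)
    , arcs s ⟩

  incRank : ℕ → State → State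
  incRank x s =
    ⟨ map (λ n → if does (nid n ≟ x) then mkNode (nid n) (full n) (key n) (suc (rank n)) else n) (nodes s)
    , arcs s ⟩

  destroy : ℕ → State → State
  destroy x s =
    ⟨ filter (λ n → ¬? (nid n ≟ x)) (nodes s)
    , filter (λ a → ¬? (proj₁ a ≟ x)) (arcs s) ⟩

  data UnrankedLink (s : State) : State → Set (c ⊔ ℓ₂) where
    ulink : ∀ w l kw kl rw rl → ¬ (w ≡ l) →
            IsRoot s w → IsRoot s l →
            FullNode s w kw rw → FullNode s l kl rl → kw ≤ₖ kl →
            UnrankedLink s (addArc w l s)

  data RankedLink (s : State) : State → Set (c ⊔ ℓ₂) where
    rlink : ∀ w l kw kl r → ¬ (w ≡ l) →
            IsRoot s w → IsRoot s l →
            FullNode s w kw r → FullNode s l kl r → kw ≤ₖ kl →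
            RankedLink s (incRank w (addArc w l s))

  data DestroyStep (s : State) : State → Set c where
    dstep : ∀ x → IsRoot s x → HollowNode s x → DestroyStep s (destroy x s)

  data Meld : State → State → State → Set (c ⊔ ℓ₂) where
    meld-emptyˡ : ∀ h → Meld emptyHeap h h
    meld-emptyʳ : ∀ h → Meld h emptyHeap h
    meld-link   : ∀ h₁ h₂ h → ∃ (IsNode h₁) → ∃ (IsNode h₂) →
                  UnrankedLink (h₁ ∪ h₂) h → Meld h₁ h₂ h

  -- Valid h : h is a two-parent hollow heap reachable from empty heaps by
  -- the heap operations (with all nondeterministic choices allowed).
  data Valid : State → Set (c ⊔ ℓ₂) where
    make-heap : Valid emptyHeap
    insert : ∀ {h h'} x k → Valid h → Fresh h x →
             Meld (single x k 0) h h' → Valid h'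
    meld : ∀ {h₁ h₂ h} → Valid h₁ → Valid h₂ → Disjoint h₁ h₂ →
           Meld h₁ h₂ h → Valid h
    decrease-key-root : ∀ {h} x k k₀ r → Valid h → IsRoot h x →
                        FullNode h x k₀ r → k <ₖ k₀ → Valid (setKey x k h)
    -- decrease-key of the item held by the non-root node u: a fresh node v
    -- of rank max{0, rank u - 2} takes the item with key k, u becomes hollow,
    -- arc (v , u) is added, and v is melded (unranked link) with the heap
    decrease-key-nonroot : ∀ {h h'} u v k k₀ r → Valid h → FullNode h u k₀ r →
                           HasParent h u → k <ₖ k₀ → Fresh h v →
                           UnrankedLink (addArc v u (makeHollow u h ∪ single v k (r ∸ 2))) h' →
                           Valid h'
    delete-nonroot : ∀ {h} u k r → Valid h → FullNode h u k r → HasParent h u →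
                     Valid (makeHollow u h)
    -- delete of the item held by the root (this includes delete-min):
    -- destroy hollow roots while there are any, then ranked links while two
    -- roots have equal rank, then unranked links until one root remains
    delete-root : ∀ {h s₁ s₂ s₃} u k r → Valid h → IsRoot h u → FullNode h u k r →
                  Star DestroyStep (makeHollow u h) s₁ → NoHollowRoot s₁ →
                  Star RankedLink s₁ s₂ → DistinctRootRanks s₂ →
                  Star UnrankedLink s₂ s₃ → AtMostOneRoot s₃ →
                  Valid s₃

{-# OPTIONS --safe #-}

-- The bound comes from a virtual forest on the nodes, as for Fibonacci heaps.
-- A node of rank r has virtual children of ranks at least r-1, r-2, ..., 0, one
-- gained per ranked link.  When decrease-key moves the item of a node u of rank r
-- to a new node v of rank r ∸ 2, u keeps its two most recent children and lends
-- the others, which fit the rank r ∸ 2, to v; they return to u when v is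
-- destroyed.  Every virtual edge runs along a path of the dag, so the forest
-- survives links and destructions.  In it a node of rank r has two distinct
-- children of ranks at least r-1 and r-2, hence at least F(r+2) ≥ φ^r
-- descendants, all of them distinct nodes of the heap.

module Submission where

open import Defs
open import Data.Nat
open import Data.Nat.Properties
open import Data.Nat.Tactic.RingSolver using (solve-∀)
open import Data.Bool using (true; false; if_then_else_)
open import Data.Product using (∃; ∃₂; _×_; _,_; proj₁; proj₂)
open import Data.Sum using (_⊎_; inj₁; inj₂; map₁)
open import Data.Empty using (⊥; ⊥-elim)
open import Function using (_∘_)
open import Data.Unit using (⊤)
open import Data.Maybe using (Maybe; just; nothing)
open import Data.Maybe.Properties using (just-injective)
open import Data.List using (List; []; _∷_; _++_; length; map; take; drop)
open import Data.List.Properties using (length-map; length-++; ++-identityʳ; take++drop≡id)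
open import Data.List.Membership.Propositional using (_∈_; _∉_; find; lose)
open import Data.List.Membership.Propositional.Properties
  using (∉[]; ∈-++⁺ˡ; ∈-++⁺ʳ; ∈-++⁻; ∈-map⁻; ∈-filter⁺; ∈-filter⁻)
open import Data.List.Membership.DecPropositional _≟_ using (_∈?_)
open import Data.List.Relation.Binary.Subset.Propositional using (_⊆_)
open import Data.List.Relation.Unary.Any as Any using (here; there)
import Data.List.Relation.Unary.Any.Properties as Anyₚ
open import Data.List.Relation.Unary.All as All using (All; []; _∷_)
import Data.List.Relation.Unary.All.Properties as Allₚ
open import Data.List.Relation.Unary.AllPairs using ([]; _∷_)
open import Data.List.Relation.Unary.Unique.Propositional using (Unique)
import Data.List.Relation.Unary.Unique.Propositional.Properties as Uniqueₚ
open import Relation.Nullary using (¬_; Dec; yes; no; does)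
open import Relation.Nullary.Decidable using (¬?; dec-true; dec-false)
open import Relation.Binary.Bundles using (TotalOrder)
open import Relation.Binary.PropositionalEquality
open import Relation.Binary.Construct.Closure.ReflexiveTransitive using (Star; ε; _◅_; _◅◅_)

-- Fibonacci numbers and powers of φ

lucas+3*fib≡2*fib[2+r] : ∀ r → lucas r + 3 * fib r ≡ 2 * fib (2 + r)
lucas+3*fib≡2*fib[2+r] 0 = refl
lucas+3*fib≡2*fib[2+r] 1 = refl
lucas+3*fib≡2*fib[2+r] (suc (suc r)) = begin
  (a + b) + 3 * (c + d)     ≡⟨ regroup a b c d ⟩
  (a + 3 * c) + (b + 3 * d) ≡⟨ cong₂ _+_ (lucas+3*fib≡2*fib[2+r] (suc r)) (lucas+3*fib≡2*fib[2+r] r) ⟩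
  2 * e + 2 * f             ≡⟨ *-distribˡ-+ 2 e f ⟨
  2 * (e + f)               ∎
  where
  open ≡-Reasoning
  a b c d e f : ℕ
  a = lucas (suc r)
  b = lucas r
  c = fib (suc r)
  d = fib r
  e = fib (3 + r)
  f = fib (2 + r)
  regroup : ∀ a b c d → (a + b) + 3 * (c + d) ≡ (a + 3 * c) + (b + 3 * d)
  regroup = solve-∀

-- φ^r = (L_r + F_r √5)/2 ≤ (L_r + 3 F_r)/2 = F_{r+2}, because √5 ≤ 3.
fib[2+r]≤N⇒PhiPow≤ : ∀ r N → fib (2 + r) ≤ N → PhiPow≤ r N
fib[2+r]≤N⇒PhiPow≤ r N F≤N = lucas≤2N , 5F²≤[2N∸lucas]²
  where
  L+3F≤2N : lucas r + 3 * fib r ≤ 2 * N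
  L+3F≤2N = subst (_≤ 2 * N) (sym (lucas+3*fib≡2*fib[2+r] r)) (*-monoʳ-≤ 2 F≤N)
  lucas≤2N : lucas r ≤ 2 * N
  lucas≤2N = ≤-trans (m≤m+n (lucas r) (3 * fib r)) L+3F≤2N
  3F≤2N∸lucas : 3 * fib r ≤ 2 * N ∸ lucas r
  3F≤2N∸lucas = subst (_≤ 2 * N ∸ lucas r) (m+n∸m≡n (lucas r) (3 * fib r)) (∸-monoˡ-≤ (lucas r) L+3F≤2N)
  9*f²≡[3f]² : ∀ f → 9 * (f * f) ≡ (3 * f) * (3 * f)
  9*f²≡[3f]² = solve-∀
  5F²≤[2N∸lucas]² : 5 * (fib r * fib r) ≤ (2 * N ∸ lucas r) * (2 * N ∸ lucas r)
  5F²≤[2N∸lucas]² = begin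
    5 * (fib r * fib r)              ≤⟨ *-monoˡ-≤ (fib r * fib r) (m≤m+n 5 4) ⟩
    9 * (fib r * fib r)              ≡⟨ 9*f²≡[3f]² (fib r) ⟩
    (3 * fib r) * (3 * fib r)        ≤⟨ *-mono-≤ 3F≤2N∸lucas 3F≤2N∸lucas ⟩
    (2 * N ∸ lucas r) * (2 * N ∸ lucas r) ∎
    where open ≤-Reasoning

module _ {a} {A : Set a} where

  Unique-++⁻ : ∀ (xs : List A) {ys} → Unique (xs ++ ys) →
               Unique xs × Unique ys × (∀ {z} → z ∈ xs → z ∈ ys → ⊥)
  Unique-++⁻ []       u          = [] , u , λ ()
  Unique-++⁻ (x ∷ xs) (x∉ ∷ u) with Unique-++⁻ xs u
  ... | uxs , uys , disjoint = Allₚ.++⁻ˡ xs x∉ ∷ uxs , uys , disjoint′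
    where
    disjoint′ : ∀ {z} → z ∈ x ∷ xs → z ∈ _ → ⊥
    disjoint′ (here refl) z∈ys = All.lookup (Allₚ.++⁻ʳ xs x∉) z∈ys refl
    disjoint′ (there z∈xs) z∈ys = disjoint z∈xs z∈ys

  remove-member : ∀ {x} {ys : List A} → x ∈ ys →
                  ∃ λ ys′ → suc (length ys′) ≡ length ys × (∀ {z} → z ∈ ys → z ≢ x → z ∈ ys′)
  remove-member {ys = y ∷ ys} (here refl) =
    ys , refl , λ { (here refl) z≢x → ⊥-elim (z≢x refl) ; (there z∈) _ → z∈ }
  remove-member {ys = y ∷ ys} (there x∈) with remove-member x∈
  ... | ys′ , len , keep =
    y ∷ ys′ , cong suc len , λ { (here refl) _ → here refl ; (there z∈) z≢x → there (keep z∈ z≢x) }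

  unique-⊆⇒length≤ : ∀ {xs ys : List A} → Unique xs → xs ⊆ ys → length xs ≤ length ys
  unique-⊆⇒length≤ {[]}     _        _     = z≤n
  unique-⊆⇒length≤ {x ∷ xs} (x∉ ∷ u) x∷xs⊆ys with remove-member (x∷xs⊆ys (here refl))
  ... | ys′ , len , keep = subst (suc (length xs) ≤_) len (s≤s (unique-⊆⇒length≤ u xs⊆ys′))
    where
    xs⊆ys′ : xs ⊆ ys′
    xs⊆ys′ z∈ = keep (x∷xs⊆ys (there z∈)) (λ z≡x → All.lookup x∉ z∈ (sym z≡x))

Staircase : (ℕ → ℕ) → ℕ → ℕ → List ℕ → Set
Staircase rk r zero    cs       = ⊤
Staircase rk r (suc k) []       = ⊥
Staircase rk r (suc k) (c ∷ cs) = r ∸ 1 ≤ rk c × Staircase rk (r ∸ 1) k cs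

module _ {rk : ℕ → ℕ} where

  Staircase-cong : ∀ {rk′} r k cs → (∀ {y} → y ∈ cs → rk′ y ≡ rk y) →
                   Staircase rk r k cs → Staircase rk′ r k cs
  Staircase-cong r zero    cs       _    _        = _
  Staircase-cong r (suc k) (c ∷ cs) same (c≥ , p) =
    subst (r ∸ 1 ≤_) (sym (same (here refl))) c≥ , Staircase-cong (r ∸ 1) k cs (λ y∈ → same (there y∈)) p

  Staircase-weaken : ∀ {r k k′} cs → k′ ≤ k → Staircase rk r k cs → Staircase rk r k′ cs
  Staircase-weaken cs       z≤n       _        = _
  Staircase-weaken (c ∷ cs) (s≤s k′≤k) (c≥ , p) = c≥ , Staircase-weaken cs k′≤k p

  Staircase-take : ∀ n {r} k cs → Staircase rk r k cs → Staircase rk r (n ⊓ k) (take n cs)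
  Staircase-take zero    k       cs       _        = _
  Staircase-take (suc n) zero    cs       _        = _
  Staircase-take (suc n) (suc k) (c ∷ cs) (c≥ , p) = c≥ , Staircase-take n k cs p

  Staircase-drop : ∀ n r cs → Staircase rk r r cs → Staircase rk (r ∸ n) (r ∸ n) (drop n cs)
  Staircase-drop zero    r       cs       p       = p
  Staircase-drop (suc n) zero    cs       _       = _
  Staircase-drop (suc n) (suc r) (c ∷ cs) (_ , p) = Staircase-drop n r cs p

  Staircase-∷ : ∀ {r} c cs → r ≤ rk c → Staircase rk r (2 ⊓ r) cs →
                Staircase rk (suc r) (2 ⊓ suc r) (c ∷ cs)
  Staircase-∷ {r} c cs c≥ p = c≥ , Staircase-weaken cs (⊓-monoˡ-≤ r (s≤s z≤n)) p

  Staircase-head : ∀ {r k} cs → Staircase rk r (suc k) cs → ∃ λ a → a ∈ cs × r ∸ 1 ≤ rk a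
  Staircase-head (c ∷ cs) (c≥ , _) = c , here refl , c≥

  Staircase-head₂ : ∀ {r k} cs → Unique cs → Staircase rk r (2 + k) cs →
                    ∃₂ λ a b → a ≢ b × a ∈ cs × b ∈ cs × r ∸ 1 ≤ rk a × r ∸ 1 ∸ 1 ≤ rk b
  Staircase-head₂ (c ∷ d ∷ cs) ((c≢d ∷ _) ∷ _) (c≥ , d≥ , _) =
    c , d , c≢d , here refl , there (here refl) , c≥ , d≥

-- Fibonacci lower bound for the size of a forest

module FibonacciForest
  {ℓ} (IsNode : ℕ → Set ℓ) (parent : ℕ → Maybe ℕ) (level rank : ℕ → ℕ) (children : ℕ → List ℕ)
  (parent-level    : ∀ {y x} → parent y ≡ just x → level y < level x)
  (child-node      : ∀ {x y} → IsNode x → y ∈ children x → IsNode y)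
  (child-parent    : ∀ {x y} → IsNode x → y ∈ children x → parent y ≡ just x)
  (unique-children : ∀ {x} → IsNode x → Unique (children x))
  (top-children    : ∀ {x} → IsNode x → Staircase rank (rank x) (2 ⊓ rank x) (children x))
  where

  _↑_ : ℕ → ℕ → Set
  y ↑ x = parent y ≡ just x

  _↑*_ : ℕ → ℕ → Set
  _↑*_ = Star _↑_

  ↑*-level : ∀ {y x} → y ↑* x → level y ≤ level x
  ↑*-level ε          = ≤-refl
  ↑*-level (y↑ ◅ ↑*x) = ≤-trans (<⇒≤ (parent-level y↑)) (↑*-level ↑*x)

  ↑*-linear : ∀ {y a b} → y ↑* a → y ↑* b → a ↑* b ⊎ b ↑* a
  ↑*-linear ε               y↑*b            = inj₁ y↑*b
  ↑*-linear y↑*a            ε               = inj₂ y↑*a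
  ↑*-linear (y↑z ◅ z↑*a)    (y↑z′ ◅ z′↑*b) with trans (sym y↑z) y↑z′
  ... | refl = ↑*-linear z↑*a z′↑*b

  siblings-disjoint : ∀ {x a b y} → a ↑ x → b ↑ x → y ↑* a → y ↑* b → a ≡ b
  siblings-disjoint a↑x b↑x y↑*a y↑*b with ↑*-linear y↑*a y↑*b
  ... | inj₁ ε                = refl
  ... | inj₂ ε                = refl
  ... | inj₁ (a↑z ◅ z↑*b) with trans (sym a↑x) a↑z
  ...   | refl = ⊥-elim (<⇒≱ (parent-level b↑x) (↑*-level z↑*b))
  siblings-disjoint a↑x b↑x _ _ | inj₂ (b↑z ◅ z↑*a) with trans (sym b↑x) b↑z
  ...   | refl = ⊥-elim (<⇒≱ (parent-level a↑x) (↑*-level z↑*a))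

  Descendant : ℕ → ℕ → Set ℓ
  Descendant x y = IsNode y × y ↑* x

  record Descendants (x m : ℕ) : Set ℓ where
    field
      members : List ℕ
      unique  : Unique members
      below   : All (Descendant x) members
      many    : m ≤ length members
  open Descendants

  leaf : ∀ {x} → IsNode x → Descendants x 1
  leaf nx = record { members = _ ∷ [] ; unique = [] ∷ [] ; below = (nx , ε) ∷ [] ; many = ≤-refl }

  graft : ∀ {x a m} → IsNode x → a ↑ x → Descendants a m → Descendants x (suc m)
  graft nx a↑x D = record
    { members = _ ∷ members D
    ; unique  = All.map x∉ (below D) ∷ unique D
    ; below   = (nx , ε) ∷ All.map (λ (ny , y↑*a) → ny , y↑*a ◅◅ (a↑x ◅ ε)) (below D)
    ; many    = s≤s (many D) }
    where
    x∉ : ∀ {y} → Descendant _ y → _ ≢ y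
    x∉ (_ , y↑*a) refl = <⇒≱ (parent-level a↑x) (↑*-level y↑*a)

  join : ∀ {x a b m n} → a ≢ b → a ↑ x → b ↑ x → Descendants a m → Descendants b n → Descendants x (m + n)
  join {m = m} a≢b a↑x b↑x A B = record
    { members = members A ++ members B
    ; unique  = Uniqueₚ.++⁺ (unique A) (unique B) disjoint
    ; below   = Allₚ.++⁺ (All.map (lift a↑x) (below A)) (All.map (lift b↑x) (below B))
    ; many    = subst (m + _ ≤_) (sym (length-++ (members A))) (+-mono-≤ (many A) (many B)) }
    where
    lift : ∀ {c y} → c ↑ _ → Descendant c y → Descendant _ y
    lift c↑x (ny , y↑*c) = ny , y↑*c ◅◅ (c↑x ◅ ε)
    disjoint : ∀ {y} → ¬ (y ∈ members A × y ∈ members B)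
    disjoint (y∈A , y∈B) =
      a≢b (siblings-disjoint a↑x b↑x (proj₂ (All.lookup (below A) y∈A)) (proj₂ (All.lookup (below B) y∈B)))

  fib-descendants : ∀ r {x} → IsNode x → r ≤ rank x → Descendants x (fib (2 + r))
  fib-descendants zero nx _ = leaf nx
  fib-descendants (suc zero) {x} nx 1≤rank =
    let a , a∈ , _ = Staircase-head (children x)
                       (Staircase-weaken (children x) (⊓-glb (s≤s z≤n) 1≤rank) (top-children nx))
    in graft nx (child-parent nx a∈) (leaf (child-node nx a∈))
  fib-descendants (suc (suc r)) {x} nx r+2≤rank =
    let a , b , a≢b , a∈ , b∈ , a≥ , b≥ =
          Staircase-head₂ (children x) (unique-children nx)
            (Staircase-weaken (children x) (⊓-glb ≤-refl (m+n≤o⇒m≤o 2 r+2≤rank)) (top-children nx))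
    in join a≢b (child-parent nx a∈) (child-parent nx b∈)
         (fib-descendants (suc r) (child-node nx a∈) (≤-trans (∸-monoˡ-≤ 1 r+2≤rank) a≥))
         (fib-descendants r (child-node nx b∈) (≤-trans (∸-monoˡ-≤ 1 (∸-monoˡ-≤ 1 r+2≤rank)) b≥))

update : {A : Set} → ℕ → A → (ℕ → A) → ℕ → A
update x a f y with y ≟ x
... | yes _ = a
... | no  _ = f y

update-≡ : ∀ {A : Set} x (a : A) f → update x a f x ≡ a
update-≡ x a f with x ≟ x
... | yes _   = refl
... | no  x≢x = ⊥-elim (x≢x refl)

update-≢ : ∀ {A : Set} {x y} (a : A) f → y ≢ x → update x a f y ≡ f y
update-≢ {x = x} {y} a f y≢x with y ≟ x
... | yes y≡x = ⊥-elim (y≢x y≡x)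
... | no  _   = refl

update-nothing⁻ : ∀ {x y v} (f : ℕ → Maybe ℕ) → update x nothing f y ≡ just v → f y ≡ just v × y ≢ x
update-nothing⁻ {x} {y} f eq with y ≟ x
... | no y≢x = eq , y≢x

reparent : ℕ → List ℕ → (ℕ → Maybe ℕ) → ℕ → Maybe ℕ
reparent x ys p z with z ∈? ys
... | yes _ = just x
... | no  _ = p z

reparent-∈ : ∀ {x ys p z} → z ∈ ys → reparent x ys p z ≡ just x
reparent-∈ {ys = ys} {z = z} z∈ with z ∈? ys
... | yes _  = refl
... | no  z∉ = ⊥-elim (z∉ z∈)

reparent-∉ : ∀ {x ys p z} → z ∉ ys → reparent x ys p z ≡ p z
reparent-∉ {ys = ys} {z = z} z∉ with z ∈? ys
... | yes z∈ = ⊥-elim (z∉ z∈)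
... | no  _  = refl

forget : ℕ → Maybe ℕ → Maybe ℕ
forget x nothing  = nothing
forget x (just p) with p ≟ x
... | yes _ = nothing
... | no  _ = just p

forget-≢ : ∀ x {m p} → m ≡ just p → p ≢ x → forget x m ≡ just p
forget-≢ x {p = p} refl p≢x with p ≟ x
... | yes p≡x = ⊥-elim (p≢x p≡x)
... | no  _   = refl

forget⁻ : ∀ x m {p} → forget x m ≡ just p → m ≡ just p × p ≢ x
forget⁻ x (just p) eq with p ≟ x
forget⁻ x (just p) refl | no p≢x = refl , p≢x

-- The virtual forest

-- secondParent u ≡ just v and replaced v ≡ just u when decrease-key moved the item
-- of u to v; lent u lists the children that u lends to v.
record Ghost : Set where
  field
    rankOf                       : ℕ → ℕ
    parent secondParent replaced : ℕ → Maybe ℕ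
    children lent                : ℕ → List ℕ
open Ghost

Family : Ghost → ℕ → List ℕ
Family g x = children g x ++ lent g x

ghost₀ : Ghost
ghost₀ = record
  { rankOf = λ _ → 0 ; parent = λ _ → nothing ; secondParent = λ _ → nothing ; replaced = λ _ → nothing
  ; children = λ _ → [] ; lent = λ _ → [] }

module Invariants {c ℓ₁ ℓ₂} (O : TotalOrder c ℓ₁ ℓ₂) where
  open HollowHeap O

  Arc : State → ℕ → ℕ → Set
  Arc s p q = (p , q) ∈ arcs s

  data Path (as : List (ℕ × ℕ)) : ℕ → ℕ → Set where
    [_] : ∀ {p q} → (p , q) ∈ as → Path as p q
    _∷_ : ∀ {p q r} → (p , q) ∈ as → Path as q r → Path as p r

  Path-mono : ∀ {as bs} → as ⊆ bs → ∀ {p q} → Path as p q → Path bs p q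
  Path-mono as⊆bs [ a ]     = [ as⊆bs a ]
  Path-mono as⊆bs (a ∷ as) = as⊆bs a ∷ Path-mono as⊆bs as

  arc-hasParent : ∀ s {p q} → Arc s p q → HasParent s q
  arc-hasParent s = Any.map (λ { refl → refl })

  path-hasParent : ∀ s {p q} → Path (arcs s) p q → HasParent s q
  path-hasParent s [ a ]    = arc-hasParent s a
  path-hasParent s (_ ∷ as) = path-hasParent s as

  hasParent⇒≢root : ∀ s {x y} → ¬ HasParent s x → HasParent s y → y ≢ x
  hasParent⇒≢root s x-root y-child refl = x-root y-child

  record Dag (s : State) : Set c where
    field
      level      : ℕ → ℕ
      arc-source : ∀ {p q} → Arc s p q → IsNode s p
      arc-target : ∀ {p q} → Arc s p q → IsNode s q
      arc-level  : ∀ {p q} → Arc s p q → level q < level p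

  -- E: nodes exempt from child-parent consistency (a hollow root about to be destroyed).
  record VirtualForest (E : ℕ → Set) (s : State) (g : Ghost) : Set c where
    field
      parent-path   : ∀ {x p} → parent g x ≡ just p → Path (arcs s) p x
      child-parent  : ∀ {x y} → IsNode s x → ¬ E x → y ∈ children g x → parent g y ≡ just x
      staircase     : ∀ {x} → IsNode s x → Staircase (rankOf g) (rankOf g x) (rankOf g x) (Family g x)
      top-staircase : ∀ {x} → IsNode s x → Staircase (rankOf g) (rankOf g x) (2 ⊓ rankOf g x) (children g x)
      unique-family : ∀ {x} → IsNode s x → Unique (Family g x)

  record SecondParents (s : State) (g : Ghost) : Set c where
    field
      lent-none              : ∀ {x} → secondParent g x ≡ nothing → lent g x ≡ []
      second-parent-arc      : ∀ {x v} → secondParent g x ≡ just v → Arc s v x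
      second-parent-hollow   : ∀ {n v} → n ∈ nodes s → secondParent g (nid n) ≡ just v → full n ≡ false
      replaced⇒second-parent : ∀ {v x} → replaced g v ≡ just x → secondParent g x ≡ just v
      second-parent⇒replaced : ∀ {v x} → secondParent g x ≡ just v → replaced g v ≡ just x
      lent-parent            : ∀ {x v y} → secondParent g x ≡ just v → y ∈ lent g x →
                               parent g y ≡ just v ⊎ y ∈ lent g v
      lent-path              : ∀ {x y} → y ∈ lent g x → Path (arcs s) x y

  record InvariantExcept (E : ℕ → Set) (s : State) (g : Ghost) : Set c where
    field
      dag       : Dag s
      node-rank : ∀ {n} → n ∈ nodes s → rank n ≡ rankOf g (nid n)
      forest    : VirtualForest E s g
      seconds   : SecondParents s g
    open Dag dag public
    open VirtualForest forest public
    open SecondParents seconds public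

  Invariant : State → Ghost → Set c
  Invariant = InvariantExcept (λ _ → ⊥)

  module Consequences {E s g} (I : InvariantExcept E s g) where
    open InvariantExcept I

    path-level : ∀ {p q} → Path (arcs s) p q → level q < level p
    path-level [ a ]    = arc-level a
    path-level (a ∷ as) = <-trans (path-level as) (arc-level a)

    path-target : ∀ {p q} → Path (arcs s) p q → IsNode s q
    path-target [ a ]    = arc-target a
    path-target (_ ∷ as) = path-target as

    hasParent-node : ∀ {y} → HasParent s y → IsNode s y
    hasParent-node y-child with find y-child
    ... | (_ , _) , a , refl = arc-target a

    parent-level : ∀ {y x} → parent g y ≡ just x → level y < level x
    parent-level y↑x = path-level (parent-path y↑x)

    parent-node : ∀ {y x} → parent g y ≡ just x → IsNode s y
    parent-node y↑x = path-target (parent-path y↑x)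

    root-parent : ∀ {x} → ¬ HasParent s x → parent g x ≡ nothing
    root-parent {x} x-root with parent g x in eq
    ... | nothing = refl
    ... | just _  = ⊥-elim (x-root (path-hasParent s (parent-path eq)))

    root-secondParent : ∀ {x} → ¬ HasParent s x → secondParent g x ≡ nothing
    root-secondParent {x} x-root with secondParent g x in eq
    ... | nothing = refl
    ... | just _  = ⊥-elim (x-root (arc-hasParent s (second-parent-arc eq)))

    root-lent : ∀ {x} → ¬ HasParent s x → lent g x ≡ []
    root-lent x-root = lent-none (root-secondParent x-root)

    root-unlent : ∀ {x y} → ¬ HasParent s y → y ∉ lent g x
    root-unlent y-root y∈ = y-root (path-hasParent s (lent-path y∈))

    family-node : ∀ {x y} → IsNode s x → ¬ E x → y ∈ Family g x → IsNode s y
    family-node {x} nx x∉E y∈ with ∈-++⁻ (children g x) y∈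
    ... | inj₁ y∈ch   = parent-node (child-parent nx x∉E y∈ch)
    ... | inj₂ y∈lent = path-target (lent-path y∈lent)

    family-hasParent : ∀ {x y} → IsNode s x → ¬ E x → y ∈ Family g x → HasParent s y
    family-hasParent {x} nx x∉E y∈ with ∈-++⁻ (children g x) y∈
    ... | inj₁ y∈ch   = path-hasParent s (parent-path (child-parent nx x∉E y∈ch))
    ... | inj₂ y∈lent = path-hasParent s (lent-path y∈lent)

  invariant⇒rank-bound : ∀ {s g} → Invariant s g → ∀ n → n ∈ nodes s → PhiPow≤ (rank n) (length (nodes s))
  invariant⇒rank-bound {s} {g} I n n∈ =
    subst (λ r → PhiPow≤ r (length (nodes s))) (sym (node-rank n∈)) (fib[2+r]≤N⇒PhiPow≤ (rankOf g (nid n)) _ (begin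
      fib (2 + rankOf g (nid n))   ≤⟨ many descendants ⟩
      length (members descendants) ≤⟨ unique-⊆⇒length≤ (unique descendants) ⊆nodes ⟩
      length (map nid (nodes s))   ≡⟨ length-map nid (nodes s) ⟩
      length (nodes s)             ∎))
    where
    open InvariantExcept I
    open Consequences I
    open FibonacciForest (IsNode s) (parent g) level (rankOf g) (children g) parent-level
           (λ nx y∈ → family-node nx (λ ()) (∈-++⁺ˡ y∈)) (λ nx → child-parent nx (λ ()))
           (λ {x} nx → proj₁ (Unique-++⁻ (children g x) (unique-family nx))) top-staircase
    open Descendants
    open ≤-Reasoning
    descendants : Descendants (nid n) (fib (2 + rankOf g (nid n)))
    descendants = fib-descendants _ (lose n∈ refl) ≤-refl
    ⊆nodes : members descendants ⊆ map nid (nodes s)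
    ⊆nodes y∈ = Anyₚ.map⁺ (Any.map sym (proj₁ (All.lookup (below descendants) y∈)))

  -- Preservation by the heap operations

  arcless-dag : ∀ ns → Dag ⟨ ns , [] ⟩
  arcless-dag ns = record { level = λ _ → 0 ; arc-source = λ () ; arc-target = λ () ; arc-level = λ () }

  arcless-invariant : ∀ ns → All (λ n → rank n ≡ 0) ns → Invariant ⟨ ns , [] ⟩ ghost₀
  arcless-invariant ns rank≡0 = record
    { dag       = arcless-dag ns
    ; node-rank = All.lookup rank≡0
    ; forest    = record
      { parent-path = λ () ; child-parent = λ _ _ () ; staircase = _ ; top-staircase = _ ; unique-family = λ _ → [] }
    ; seconds   = record
      { lent-none = λ _ → refl ; second-parent-arc = λ () ; second-parent-hollow = λ _ ()
      ; replaced⇒second-parent = λ () ; second-parent⇒replaced = λ () ; lent-parent = λ () ; lent-path = λ () } }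

  module NodeMap (f : Node → Node) (f-nid : ∀ n → nid (f n) ≡ nid n) where

    mapNodes : State → State
    mapNodes s = ⟨ map f (nodes s) , arcs s ⟩

    IsNode-map⁺ : ∀ s {y} → IsNode s y → IsNode (mapNodes s) y
    IsNode-map⁺ s p = Anyₚ.map⁺ (Any.map (λ {n} e → trans (f-nid n) e) p)

    IsNode-map⁻ : ∀ s {y} → IsNode (mapNodes s) y → IsNode s y
    IsNode-map⁻ s p = Any.map (λ {n} e → trans (sym (f-nid n)) e) (Anyₚ.map⁻ p)

    mapNodes-dag : ∀ {s} → Dag s → Dag (mapNodes s)
    mapNodes-dag {s} D = record
      { level = level ; arc-source = λ a → IsNode-map⁺ s (arc-source a)
      ; arc-target = λ a → IsNode-map⁺ s (arc-target a) ; arc-level = arc-level }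
      where open Dag D

    map-invariant : ∀ {s g} → (∀ n → rank (f n) ≡ rank n) → (∀ n → full n ≡ false → full (f n) ≡ false) →
                    Invariant s g → Invariant (mapNodes s) g
    map-invariant {s} {g} f-rank f-hollow I = record
      { dag       = mapNodes-dag dag
      ; node-rank = node-rank′
      ; forest    = record
        { parent-path   = parent-path
        ; child-parent  = λ nx → child-parent (IsNode-map⁻ s nx)
        ; staircase     = λ nx → staircase (IsNode-map⁻ s nx)
        ; top-staircase = λ nx → top-staircase (IsNode-map⁻ s nx)
        ; unique-family = λ nx → unique-family (IsNode-map⁻ s nx) }
      ; seconds   = record
        { lent-none = lent-none ; second-parent-arc = second-parent-arc ; second-parent-hollow = second-parent-hollow′
        ; replaced⇒second-parent = replaced⇒second-parent ; second-parent⇒replaced = second-parent⇒replaced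
        ; lent-parent = lent-parent ; lent-path = lent-path } }
      where
      open InvariantExcept I
      node-rank′ : ∀ {n′} → n′ ∈ map f (nodes s) → rank n′ ≡ rankOf g (nid n′)
      node-rank′ n′∈ with ∈-map⁻ f n′∈
      ... | n , n∈ , refl = trans (f-rank n) (trans (node-rank n∈) (cong (rankOf g) (sym (f-nid n))))
      second-parent-hollow′ : ∀ {n′ v} → n′ ∈ map f (nodes s) → secondParent g (nid n′) ≡ just v → full n′ ≡ false
      second-parent-hollow′ n′∈ sp with ∈-map⁻ f n′∈
      ... | n , n∈ , refl = f-hollow n (second-parent-hollow n∈ (subst (λ m → secondParent g m ≡ just _) (f-nid n) sp))

  onNode : ℕ → (Node → Node) → Node → Node
  onNode x F n = if does (nid n ≟ x) then F n else n

  onNode-preserves : ∀ (R : Node → Node → Set) x F → (∀ n → R n n) → (∀ n → R n (F n)) → ∀ n → R n (onNode x F n)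
  onNode-preserves R x F R-refl R-F n with does (nid n ≟ x)
  ... | true  = R-F n
  ... | false = R-refl n

  onNode-≡ : ∀ {x} F n → nid n ≡ x → onNode x F n ≡ F n
  onNode-≡ {x} F n n≡x = cong (λ b → if b then F n else n) (dec-true (nid n ≟ x) n≡x)

  onNode-≢ : ∀ {x} F n → nid n ≢ x → onNode x F n ≡ n
  onNode-≢ {x} F n n≢x = cong (λ b → if b then F n else n) (dec-false (nid n ≟ x) n≢x)

  onNode-nid : ∀ x F → (∀ n → nid (F n) ≡ nid n) → ∀ n → nid (onNode x F n) ≡ nid n
  onNode-nid x F F-nid = onNode-preserves (λ n m → nid m ≡ nid n) x F (λ _ → refl) F-nid

  onNode-invariant : ∀ {s g} x F (F-nid : ∀ n → nid (F n) ≡ nid n) → (∀ n → rank (F n) ≡ rank n) →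
                     (∀ n → full n ≡ false → full (F n) ≡ false) →
                     Invariant s g → Invariant (NodeMap.mapNodes (onNode x F) (onNode-nid x F F-nid) s) g
  onNode-invariant x F F-nid F-rank F-hollow =
    NodeMap.map-invariant (onNode x F) (onNode-nid x F F-nid)
      (onNode-preserves (λ n m → rank m ≡ rank n) x F (λ _ → refl) F-rank)
      (onNode-preserves (λ n m → full n ≡ false → full m ≡ false) x F (λ _ h → h) F-hollow)

  hollowed : Node → Node
  hollowed n = mkNode (nid n) false (key n) (rank n)

  module MakeHollow (x : ℕ) = NodeMap (onNode x hollowed) (onNode-nid x hollowed (λ _ → refl))

  makeHollow-invariant : ∀ {s g} x → Invariant s g → Invariant (makeHollow x s) g
  makeHollow-invariant x = onNode-invariant x hollowed (λ _ → refl) (λ _ → refl) (λ _ _ → refl)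

  makeHollow-hollow : ∀ s x {n} → n ∈ nodes (makeHollow x s) → nid n ≡ x → full n ≡ false
  makeHollow-hollow s x n∈ n≡x with ∈-map⁻ (onNode x hollowed) n∈
  ... | m , _ , refl = cong full (onNode-≡ hollowed m (trans (sym (onNode-nid x hollowed (λ _ → refl) m)) n≡x))

  setKey-invariant : ∀ {s g} x k → Invariant s g → Invariant (setKey x k s) g
  setKey-invariant x k = onNode-invariant x (λ n → mkNode (nid n) (full n) k (rank n)) (λ _ → refl) (λ _ → refl) (λ _ h → h)

  exempt : ∀ {F s g} → Invariant s g → InvariantExcept F s g
  exempt I = record
    { dag = dag ; node-rank = node-rank ; seconds = seconds
    ; forest = record
      { parent-path = parent-path ; child-parent = λ nx _ → child-parent nx (λ ())
      ; staircase = staircase ; top-staircase = top-staircase ; unique-family = unique-family } }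
    where open InvariantExcept I

  addArc-forest : ∀ {E s g} p q → VirtualForest E s g → VirtualForest E (addArc p q s) g
  addArc-forest p q F = record
    { parent-path = λ x↑ → Path-mono there (parent-path x↑)
    ; child-parent = child-parent ; staircase = staircase ; top-staircase = top-staircase ; unique-family = unique-family }
    where open VirtualForest F

  addArc-seconds : ∀ {s g} p q → SecondParents s g → SecondParents (addArc p q s) g
  addArc-seconds p q S = record
    { lent-none = lent-none ; second-parent-arc = λ sp → there (second-parent-arc sp)
    ; second-parent-hollow = second-parent-hollow
    ; replaced⇒second-parent = replaced⇒second-parent ; second-parent⇒replaced = second-parent⇒replaced
    ; lent-parent = lent-parent ; lent-path = λ y∈ → Path-mono there (lent-path y∈) }
    where open SecondParents S

  -- Only the level of the new parent w is raised, which is harmless as w is a root.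
  link-dag : ∀ {s w l} → w ≢ l → IsRoot s w → IsNode s l → Dag s → Dag (addArc w l s)
  link-dag {s} {w} {l} w≢l (nw , w-root) nl D = record
    { level      = level′
    ; arc-source = λ { (here refl) → nw ; (there a) → arc-source a }
    ; arc-target = λ { (here refl) → nl ; (there a) → arc-target a }
    ; arc-level  = λ { (here refl) → l<w ; (there a) → old-arc a } }
    where
    open Dag D
    level′ : ℕ → ℕ
    level′ = update w (suc (level w + level l)) level
    level≤level′ : ∀ p → level p ≤ level′ p
    level≤level′ p with p ≟ w
    ... | yes refl = m≤n⇒m≤1+n (m≤m+n (level p) (level l))
    ... | no  _    = ≤-refl
    l<w : level′ l < level′ w
    l<w = subst₂ _<_ (sym (update-≢ _ level (w≢l ∘ sym))) (sym (update-≡ w _ level)) (s≤s (m≤n+m (level l) (level w)))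
    old-arc : ∀ {p q} → Arc s p q → level′ q < level′ p
    old-arc {p} a = subst (_< level′ p) (sym (update-≢ _ level (hasParent⇒≢root s w-root (arc-hasParent s a))))
                          (<-≤-trans (arc-level a) (level≤level′ p))

  link-invariant : ∀ {s g w l} → w ≢ l → IsRoot s w → IsNode s l → Invariant s g → Invariant (addArc w l s) g
  link-invariant {w = w} {l} w≢l w-root nl I = record
    { dag = link-dag w≢l w-root nl dag ; node-rank = node-rank
    ; forest = addArc-forest w l forest ; seconds = addArc-seconds w l seconds }
    where open InvariantExcept I

  unrankedLink-invariant : ∀ {s s′ g} → UnrankedLink s s′ → Invariant s g → Invariant s′ g
  unrankedLink-invariant (ulink _ _ _ _ _ _ w≢l w-root (nl , _) _ _ _) = link-invariant w≢l w-root nl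

  -- A ranked link is an unranked link followed by this promotion of the winner w.
  promote : Ghost → ℕ → ℕ → ℕ → Ghost
  promote g w l r = record g
    { rankOf   = update w (suc r) (rankOf g)
    ; parent   = update l (just w) (parent g)
    ; children = update w (l ∷ children g w) (children g) }

  incremented : Node → Node
  incremented n = mkNode (nid n) (full n) (key n) (suc (rank n))

  module Promotion {s g w l r} (I : Invariant s g) (w≢l : w ≢ l) (w-root : ¬ HasParent s w) (w→l : Arc s w l)
                   (l-orphan : parent g l ≡ nothing) (l-unlent : ∀ {x} → l ∉ lent g x)
                   (rank-w : rankOf g w ≡ r) (rank-l : rankOf g l ≡ r) where
    open InvariantExcept I
    open Consequences I

    g′ : Ghost
    g′ = promote g w l r

    child≢l : ∀ {x y} → IsNode s x → y ∈ children g x → y ≢ l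
    child≢l nx y∈ refl with trans (sym l-orphan) (child-parent nx (λ ()) y∈)
    ... | ()

    l∉family : ∀ {x} → IsNode s x → l ∉ Family g x
    l∉family {x} nx l∈ with ∈-++⁻ (children g x) l∈
    ... | inj₁ l∈ch   = child≢l nx l∈ch refl
    ... | inj₂ l∈lent = l-unlent l∈lent

    family-rank : ∀ {x y} → IsNode s x → y ∈ Family g x → rankOf g′ y ≡ rankOf g y
    family-rank nx y∈ = update-≢ _ (rankOf g) (hasParent⇒≢root s w-root (family-hasParent nx (λ ()) y∈))

    rank′-l : rankOf g′ l ≡ r
    rank′-l = trans (update-≢ _ (rankOf g) (w≢l ∘ sym)) rank-l

    nid-kept : ∀ n → nid (onNode w incremented n) ≡ nid n
    nid-kept = onNode-nid w incremented (λ _ → refl)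

    promoted-rank : ∀ {n} → n ∈ nodes s → rank (onNode w incremented n) ≡ rankOf g′ (nid n)
    promoted-rank {n} n∈ with nid n ≟ w
    ... | yes n≡w = trans (cong rank (onNode-≡ incremented n n≡w))
                          (cong suc (trans (node-rank n∈) (trans (cong (rankOf g) n≡w) rank-w)))
    ... | no  n≢w = trans (cong rank (onNode-≢ incremented n n≢w)) (node-rank n∈)

    open NodeMap (onNode w incremented) nid-kept

    node-rank′ : ∀ {n′} → n′ ∈ nodes (incRank w s) → rank n′ ≡ rankOf g′ (nid n′)
    node-rank′ n′∈ with ∈-map⁻ (onNode w incremented) n′∈
    ... | n , n∈ , refl = trans (promoted-rank n∈) (cong (rankOf g′) (sym (nid-kept n)))

    parent-path′ : ∀ {x p} → parent g′ x ≡ just p → Path (arcs s) p x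
    parent-path′ {x} x↑p with x ≟ l
    ... | yes refl = subst (λ p → Path (arcs s) p l) (just-injective x↑p) [ w→l ]
    ... | no  _    = parent-path x↑p

    child-parent′ : ∀ {x y} → IsNode s x → y ∈ children g′ x → parent g′ y ≡ just x
    child-parent′ {x} nx y∈ with x ≟ w
    child-parent′ nx (here refl)  | yes refl = update-≡ l (just w) (parent g)
    child-parent′ nx (there y∈)   | yes refl = trans (update-≢ _ (parent g) (child≢l nx y∈)) (child-parent nx (λ ()) y∈)
    child-parent′ nx y∈           | no  _    = trans (update-≢ _ (parent g) (child≢l nx y∈)) (child-parent nx (λ ()) y∈)

    staircase′ : ∀ {x} → IsNode s x → Staircase (rankOf g′) (rankOf g′ x) (rankOf g′ x) (Family g′ x)
    staircase′ {x} nx with x ≟ w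
    ... | yes refl = ≤-reflexive (sym rank′-l) ,
                     Staircase-cong r r (Family g w) (family-rank nx)
                       (subst (λ k → Staircase (rankOf g) k k (Family g w)) rank-w (staircase nx))
    ... | no  _    = Staircase-cong _ _ (Family g x) (family-rank nx) (staircase nx)

    top-staircase′ : ∀ {x} → IsNode s x → Staircase (rankOf g′) (rankOf g′ x) (2 ⊓ rankOf g′ x) (children g′ x)
    top-staircase′ {x} nx with x ≟ w
    ... | yes refl = Staircase-∷ l (children g w) (≤-reflexive (sym rank′-l))
                       (Staircase-cong r _ (children g w) (family-rank nx ∘ ∈-++⁺ˡ)
                         (subst (λ k → Staircase (rankOf g) k (2 ⊓ k) (children g w)) rank-w (top-staircase nx)))
    ... | no  _    = Staircase-cong _ _ (children g x) (family-rank nx ∘ ∈-++⁺ˡ) (top-staircase nx)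

    unique-family′ : ∀ {x} → IsNode s x → Unique (Family g′ x)
    unique-family′ {x} nx with x ≟ w
    ... | yes refl = All.tabulate (λ y∈ l≡y → l∉family nx (subst (_∈ Family g w) (sym l≡y) y∈)) ∷ unique-family nx
    ... | no  _    = unique-family nx

    second-parent-hollow′ : ∀ {n′ v} → n′ ∈ nodes (incRank w s) → secondParent g (nid n′) ≡ just v → full n′ ≡ false
    second-parent-hollow′ n′∈ sp with ∈-map⁻ (onNode w incremented) n′∈
    ... | n , n∈ , refl =
      onNode-preserves (λ n m → full n ≡ false → full m ≡ false) w incremented (λ _ h → h) (λ _ h → h) n
        (second-parent-hollow n∈ (subst (λ m → secondParent g m ≡ just _) (nid-kept n) sp))

    lent-parent′ : ∀ {x v y} → secondParent g x ≡ just v → y ∈ lent g x → parent g′ y ≡ just v ⊎ y ∈ lent g v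
    lent-parent′ sp y∈ with lent-parent sp y∈
    ... | inj₁ y↑v  = inj₁ (trans (update-≢ _ (parent g) (λ { refl → l-unlent y∈ })) y↑v)
    ... | inj₂ y∈′  = inj₂ y∈′

    invariant : Invariant (incRank w s) g′
    invariant = record
      { dag       = mapNodes-dag dag
      ; node-rank = node-rank′
      ; forest    = record
        { parent-path   = parent-path′
        ; child-parent  = λ nx _ → child-parent′ (IsNode-map⁻ s nx)
        ; staircase     = λ nx → staircase′ (IsNode-map⁻ s nx)
        ; top-staircase = λ nx → top-staircase′ (IsNode-map⁻ s nx)
        ; unique-family = λ nx → unique-family′ (IsNode-map⁻ s nx) }
      ; seconds   = record
        { lent-none = lent-none ; second-parent-arc = second-parent-arc ; second-parent-hollow = second-parent-hollow′
        ; replaced⇒second-parent = replaced⇒second-parent ; second-parent⇒replaced = second-parent⇒replaced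
        ; lent-parent = lent-parent′ ; lent-path = lent-path } }

  rankedLink-invariant : ∀ {s s′ g} → RankedLink s s′ → Invariant s g → ∃ (Invariant s′)
  rankedLink-invariant {s} (rlink w l _ _ r w≢l (nw , w-root) (nl , l-root) fw fl _) I =
    _ , Promotion.invariant (link-invariant w≢l (nw , w-root) nl I) w≢l w-root′ (here refl)
                            (root-parent l-root) (root-unlent l-root) (sym (node-rank fw)) (sym (node-rank fl))
    where
    open InvariantExcept I
    open Consequences I
    w-root′ : ¬ HasParent (addArc w l s) w
    w-root′ (here l≡w) = w≢l (sym l≡w)
    w-root′ (there h)  = w-root h

  isNode? : ∀ s y → Dec (IsNode s y)
  isNode? s y = Any.any? (λ n → nid n ≟ y) (nodes s)

  choose : {A : Set} → State → (ℕ → A) → (ℕ → A) → ℕ → A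
  choose s f₁ f₂ y with isNode? s y
  ... | yes _ = f₁ y
  ... | no  _ = f₂ y

  choose₁ : ∀ {A : Set} s {y} (f₁ f₂ : ℕ → A) → IsNode s y → choose s f₁ f₂ y ≡ f₁ y
  choose₁ s {y} f₁ f₂ ny with isNode? s y
  ... | yes _  = refl
  ... | no ¬ny = ⊥-elim (¬ny ny)

  choose₂ : ∀ {A : Set} s {y} (f₁ f₂ : ℕ → A) → ¬ IsNode s y → choose s f₁ f₂ y ≡ f₂ y
  choose₂ s {y} f₁ f₂ ¬ny with isNode? s y
  ... | yes ny = ⊥-elim (¬ny ny)
  ... | no  _  = refl

  union-dag : ∀ {h₁ h₂} → Dag h₁ → Dag h₂ → Disjoint h₁ h₂ → Dag (h₁ ∪ h₂)
  union-dag {h₁} {h₂} D₁ D₂ disjoint = record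
    { level      = level
    ; arc-source = proj₁ ∘ arc-nodes
    ; arc-target = proj₂ ∘ arc-nodes
    ; arc-level  = arc-level }
    where
    module D₁ = Dag D₁
    module D₂ = Dag D₂
    ¬₁ : ∀ {y} → IsNode h₂ y → ¬ IsNode h₁ y
    ¬₁ {y} n₂ n₁ = disjoint y n₁ n₂
    level : ℕ → ℕ
    level = choose h₁ D₁.level D₂.level
    arc-nodes : ∀ {p q} → Arc (h₁ ∪ h₂) p q → IsNode (h₁ ∪ h₂) p × IsNode (h₁ ∪ h₂) q
    arc-nodes a with ∈-++⁻ (arcs h₁) a
    ... | inj₁ a₁ = Anyₚ.++⁺ˡ (D₁.arc-source a₁) , Anyₚ.++⁺ˡ (D₁.arc-target a₁)
    ... | inj₂ a₂ = Anyₚ.++⁺ʳ (nodes h₁) (D₂.arc-source a₂) , Anyₚ.++⁺ʳ (nodes h₁) (D₂.arc-target a₂)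
    arc-level : ∀ {p q} → Arc (h₁ ∪ h₂) p q → level q < level p
    arc-level a with ∈-++⁻ (arcs h₁) a
    ... | inj₁ a₁ = subst₂ _<_ (sym (choose₁ h₁ _ _ (D₁.arc-target a₁))) (sym (choose₁ h₁ _ _ (D₁.arc-source a₁)))
                           (D₁.arc-level a₁)
    ... | inj₂ a₂ = subst₂ _<_ (sym (choose₂ h₁ _ _ (¬₁ (D₂.arc-target a₂))))
                               (sym (choose₂ h₁ _ _ (¬₁ (D₂.arc-source a₂))))
                           (D₂.arc-level a₂)

  merge : State → Ghost → Ghost → Ghost
  merge h g₁ g₂ = record
    { rankOf = choose h (rankOf g₁) (rankOf g₂) ; parent = choose h (parent g₁) (parent g₂)
    ; secondParent = choose h (secondParent g₁) (secondParent g₂) ; replaced = choose h (replaced g₁) (replaced g₂)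
    ; children = choose h (children g₁) (children g₂) ; lent = choose h (lent g₁) (lent g₂) }

  module Union {h₁ h₂ g₁ g₂} (I₁ : Invariant h₁ g₁) (I₂ : Invariant h₂ g₂) (disjoint : Disjoint h₁ h₂) where
    module I₁ = InvariantExcept I₁
    module I₂ = InvariantExcept I₂
    module C₁ = Consequences I₁
    module C₂ = Consequences I₂

    s : State
    s = h₁ ∪ h₂

    g : Ghost
    g = merge h₁ g₁ g₂

    ¬₁ : ∀ {y} → IsNode h₂ y → ¬ IsNode h₁ y
    ¬₁ {y} n₂ n₁ = disjoint y n₁ n₂

    dag : Dag s
    dag = union-dag I₁.dag I₂.dag disjoint

    node-rank : ∀ {n} → n ∈ nodes s → rank n ≡ rankOf g (nid n)
    node-rank {n} n∈ with ∈-++⁻ (nodes h₁) n∈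
    ... | inj₁ n∈₁ = trans (I₁.node-rank n∈₁) (sym (choose₁ h₁ _ _ (lose n∈₁ refl)))
    ... | inj₂ n∈₂ = trans (I₂.node-rank n∈₂) (sym (choose₂ h₁ _ _ (¬₁ (lose n∈₂ refl))))

    forest : VirtualForest (λ _ → ⊥) s g
    forest = record
      { parent-path   = parent-path
      ; child-parent  = child-parent
      ; staircase     = staircase
      ; top-staircase = top-staircase
      ; unique-family = unique-family }
      where
      parent-path : ∀ {z p} → parent g z ≡ just p → Path (arcs s) p z
      parent-path {z} z↑ with isNode? h₁ z
      ... | yes _ = Path-mono ∈-++⁺ˡ (I₁.parent-path z↑)
      ... | no  _ = Path-mono (∈-++⁺ʳ (arcs h₁)) (I₂.parent-path z↑)
      child-parent : ∀ {z w} → IsNode s z → ¬ ⊥ → w ∈ children g z → parent g w ≡ just z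
      child-parent {z} nz _ w∈ with isNode? h₁ z | Anyₚ.++⁻ (nodes h₁) nz
      ... | yes n₁ | _ = let w↑ = I₁.child-parent n₁ (λ ()) w∈ in trans (choose₁ h₁ _ _ (C₁.parent-node w↑)) w↑
      ... | no ¬n₁ | inj₁ n₁ = ⊥-elim (¬n₁ n₁)
      ... | no _   | inj₂ n₂ = let w↑ = I₂.child-parent n₂ (λ ()) w∈ in
                                trans (choose₂ h₁ _ _ (¬₁ (C₂.parent-node w↑))) w↑
      staircase : ∀ {z} → IsNode s z → Staircase (rankOf g) (rankOf g z) (rankOf g z) (Family g z)
      staircase {z} nz with isNode? h₁ z | Anyₚ.++⁻ (nodes h₁) nz
      ... | yes n₁ | _       = Staircase-cong _ _ _ (λ y∈ → choose₁ h₁ _ _ (C₁.family-node n₁ (λ ()) y∈)) (I₁.staircase n₁)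
      ... | no ¬n₁ | inj₁ n₁ = ⊥-elim (¬n₁ n₁)
      ... | no _   | inj₂ n₂ = Staircase-cong _ _ _ (λ y∈ → choose₂ h₁ _ _ (¬₁ (C₂.family-node n₂ (λ ()) y∈)))
                                 (I₂.staircase n₂)
      top-staircase : ∀ {z} → IsNode s z → Staircase (rankOf g) (rankOf g z) (2 ⊓ rankOf g z) (children g z)
      top-staircase {z} nz with isNode? h₁ z | Anyₚ.++⁻ (nodes h₁) nz
      ... | yes n₁ | _       = Staircase-cong _ _ _ (λ y∈ → choose₁ h₁ _ _ (C₁.family-node n₁ (λ ()) (∈-++⁺ˡ y∈)))
                                 (I₁.top-staircase n₁)
      ... | no ¬n₁ | inj₁ n₁ = ⊥-elim (¬n₁ n₁)
      ... | no _   | inj₂ n₂ = Staircase-cong _ _ _ (λ y∈ → choose₂ h₁ _ _ (¬₁ (C₂.family-node n₂ (λ ()) (∈-++⁺ˡ y∈))))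
                                 (I₂.top-staircase n₂)
      unique-family : ∀ {z} → IsNode s z → Unique (Family g z)
      unique-family {z} nz with isNode? h₁ z | Anyₚ.++⁻ (nodes h₁) nz
      ... | yes n₁ | _       = I₁.unique-family n₁
      ... | no ¬n₁ | inj₁ n₁ = ⊥-elim (¬n₁ n₁)
      ... | no _   | inj₂ n₂ = I₂.unique-family n₂

    seconds : SecondParents s g
    seconds = record
      { lent-none              = lent-none
      ; second-parent-arc      = second-parent-arc
      ; second-parent-hollow   = second-parent-hollow
      ; replaced⇒second-parent = replaced⇒second-parent
      ; second-parent⇒replaced = second-parent⇒replaced
      ; lent-parent            = lent-parent
      ; lent-path              = lent-path }
      where
      lent-none : ∀ {z} → secondParent g z ≡ nothing → lent g z ≡ []
      lent-none {z} sp with isNode? h₁ z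
      ... | yes _ = I₁.lent-none sp
      ... | no  _ = I₂.lent-none sp
      second-parent-arc : ∀ {z v} → secondParent g z ≡ just v → Arc s v z
      second-parent-arc {z} sp with isNode? h₁ z
      ... | yes _ = ∈-++⁺ˡ (I₁.second-parent-arc sp)
      ... | no  _ = ∈-++⁺ʳ (arcs h₁) (I₂.second-parent-arc sp)
      second-parent-hollow : ∀ {n v} → n ∈ nodes s → secondParent g (nid n) ≡ just v → full n ≡ false
      second-parent-hollow {n} n∈ sp with ∈-++⁻ (nodes h₁) n∈
      ... | inj₁ n∈₁ = I₁.second-parent-hollow n∈₁ (trans (sym (choose₁ h₁ _ _ (lose n∈₁ refl))) sp)
      ... | inj₂ n∈₂ = I₂.second-parent-hollow n∈₂ (trans (sym (choose₂ h₁ _ _ (¬₁ (lose n∈₂ refl)))) sp)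
      replaced⇒second-parent : ∀ {v z} → replaced g v ≡ just z → secondParent g z ≡ just v
      replaced⇒second-parent {v} rp with isNode? h₁ v
      ... | yes _ = let sp = I₁.replaced⇒second-parent rp in
                    trans (choose₁ h₁ _ _ (I₁.arc-target (I₁.second-parent-arc sp))) sp
      ... | no  _ = let sp = I₂.replaced⇒second-parent rp in
                    trans (choose₂ h₁ _ _ (¬₁ (I₂.arc-target (I₂.second-parent-arc sp)))) sp
      second-parent⇒replaced : ∀ {v z} → secondParent g z ≡ just v → replaced g v ≡ just z
      second-parent⇒replaced {v} {z} sp with isNode? h₁ z
      ... | yes _ = trans (choose₁ h₁ _ _ (I₁.arc-source (I₁.second-parent-arc sp))) (I₁.second-parent⇒replaced sp)
      ... | no  _ = trans (choose₂ h₁ _ _ (¬₁ (I₂.arc-source (I₂.second-parent-arc sp)))) (I₂.second-parent⇒replaced sp)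
      lent-parent : ∀ {z v w} → secondParent g z ≡ just v → w ∈ lent g z → parent g w ≡ just v ⊎ w ∈ lent g v
      lent-parent {z} {v} {w} sp w∈ with isNode? h₁ z
      ... | yes _ with I₁.lent-parent sp w∈
      ...   | inj₁ w↑ = inj₁ (trans (choose₁ h₁ _ _ (C₁.path-target (I₁.lent-path w∈))) w↑)
      ...   | inj₂ w∈′ = inj₂ (subst (w ∈_) (sym (choose₁ h₁ _ _ (I₁.arc-source (I₁.second-parent-arc sp)))) w∈′)
      lent-parent {z} {v} {w} sp w∈ | no _ with I₂.lent-parent sp w∈
      ...   | inj₁ w↑ = inj₁ (trans (choose₂ h₁ _ _ (¬₁ (C₂.path-target (I₂.lent-path w∈)))) w↑)
      ...   | inj₂ w∈′ = inj₂ (subst (w ∈_) (sym (choose₂ h₁ _ _ (¬₁ (I₂.arc-source (I₂.second-parent-arc sp))))) w∈′)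
      lent-path : ∀ {z w} → w ∈ lent g z → Path (arcs s) z w
      lent-path {z} w∈ with isNode? h₁ z
      ... | yes _ = Path-mono ∈-++⁺ˡ (I₁.lent-path w∈)
      ... | no  _ = Path-mono (∈-++⁺ʳ (arcs h₁)) (I₂.lent-path w∈)

    invariant : Invariant s g
    invariant = record { dag = dag ; node-rank = node-rank ; forest = forest ; seconds = seconds }

  meld-invariant : ∀ {h₁ h₂ h g₁ g₂} → Meld h₁ h₂ h → Invariant h₁ g₁ → Invariant h₂ g₂ → Disjoint h₁ h₂ →
                   ∃ (Invariant h)
  meld-invariant (meld-emptyˡ _)             _  I₂ _        = _ , I₂
  meld-invariant (meld-emptyʳ _)             I₁ _  _        = _ , I₁
  meld-invariant (meld-link _ _ _ _ _ link) I₁ I₂ disjoint =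
    _ , unrankedLink-invariant link (Union.invariant I₁ I₂ disjoint)

  regain : Ghost → ℕ → ℕ → Ghost
  regain g x y = record g
    { parent       = reparent y (lent g y) (parent g)
    ; children     = update y (Family g y) (children g)
    ; lent         = update y [] (lent g)
    ; secondParent = update y nothing (secondParent g)
    ; replaced     = update x nothing (replaced g) }

  -- x is a hollow root about to be destroyed, and the second parent of y:
  -- y takes back the children it lent to x.
  module Regain {s g x y} (I : Invariant s g) (x-root : IsRoot s x) (x-replaced-y : replaced g x ≡ just y) where
    open InvariantExcept I hiding (forest; seconds)
    open Consequences I

    g′ : Ghost
    g′ = regain g x y

    y↑₂x : secondParent g y ≡ just x
    y↑₂x = replaced⇒second-parent x-replaced-y

    y≢x : y ≢ x
    y≢x = hasParent⇒≢root s (proj₂ x-root) (arc-hasParent s (second-parent-arc y↑₂x))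

    lent-y↑x : ∀ {w} → w ∈ lent g y → parent g w ≡ just x
    lent-y↑x w∈ with lent-parent y↑₂x w∈
    ... | inj₁ w↑x = w↑x
    ... | inj₂ w∈x = ⊥-elim (∉[] (subst (_ ∈_) (root-lent (proj₂ x-root)) w∈x))

    forest : VirtualForest (_≡ x) s g′
    forest = record
      { parent-path   = parent-path′
      ; child-parent  = child-parent′
      ; staircase     = staircase′
      ; top-staircase = top-staircase′
      ; unique-family = unique-family′ }
      where
      parent-path′ : ∀ {z p} → parent g′ z ≡ just p → Path (arcs s) p z
      parent-path′ {z} z↑ with z ∈? lent g y
      ... | yes z∈ = subst (λ p → Path (arcs s) p z) (just-injective z↑) (lent-path z∈)
      ... | no  _  = parent-path z↑
      child-parent′ : ∀ {z w} → IsNode s z → z ≢ x → w ∈ children g′ z → parent g′ w ≡ just z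
      child-parent′ {z} {w} nz z≢x w∈ with z ≟ y
      ... | yes refl with w ∈? lent g z
      ...   | yes _  = refl
      ...   | no  w∉ with ∈-++⁻ (children g z) w∈
      ...     | inj₁ w∈ch   = child-parent nz (λ ()) w∈ch
      ...     | inj₂ w∈lent = ⊥-elim (w∉ w∈lent)
      child-parent′ {z} {w} nz z≢x w∈ | no _ with w ∈? lent g y
      ...   | yes w∈lent = ⊥-elim (z≢x (just-injective (trans (sym (child-parent nz (λ ()) w∈)) (lent-y↑x w∈lent))))
      ...   | no  _      = child-parent nz (λ ()) w∈
      staircase′ : ∀ {z} → IsNode s z → Staircase (rankOf g) (rankOf g z) (rankOf g z) (Family g′ z)
      staircase′ {z} nz with z ≟ y
      ... | yes refl = subst (Staircase (rankOf g) (rankOf g z) (rankOf g z)) (sym (++-identityʳ _)) (staircase nz)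
      ... | no  _    = staircase nz
      top-staircase′ : ∀ {z} → IsNode s z → Staircase (rankOf g) (rankOf g z) (2 ⊓ rankOf g z) (children g′ z)
      top-staircase′ {z} nz with z ≟ y
      ... | yes refl = Staircase-weaken (Family g z) (m⊓n≤n 2 _) (staircase nz)
      ... | no  _    = top-staircase nz
      unique-family′ : ∀ {z} → IsNode s z → Unique (Family g′ z)
      unique-family′ {z} nz with z ≟ y
      ... | yes refl = subst Unique (sym (++-identityʳ _)) (unique-family nz)
      ... | no  _    = unique-family nz

    seconds : SecondParents s g′
    seconds = record
      { lent-none              = λ {z} → lent-none′ {z}
      ; second-parent-arc      = λ sp → second-parent-arc (proj₁ (update-nothing⁻ (secondParent g) sp))
      ; second-parent-hollow   = λ n∈ sp → second-parent-hollow n∈ (proj₁ (update-nothing⁻ (secondParent g) sp))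
      ; replaced⇒second-parent = replaced⇒second-parent′
      ; second-parent⇒replaced = second-parent⇒replaced′
      ; lent-parent            = λ {z} {v} {w} → lent-parent′ {z} {v} {w}
      ; lent-path              = λ {z} → lent-path′ {z} }
      where
      lent-none′ : ∀ {z} → secondParent g′ z ≡ nothing → lent g′ z ≡ []
      lent-none′ {z} sp with z ≟ y
      ... | yes refl = refl
      ... | no  _    = lent-none sp
      replaced⇒second-parent′ : ∀ {v z} → replaced g′ v ≡ just z → secondParent g′ z ≡ just v
      replaced⇒second-parent′ {v} {z} rp with update-nothing⁻ (replaced g) rp
      ... | rp′ , v≢x with z ≟ y
      ...   | yes refl = ⊥-elim (v≢x (just-injective (trans (sym (replaced⇒second-parent rp′)) y↑₂x)))
      ...   | no  _    = replaced⇒second-parent rp′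
      second-parent⇒replaced′ : ∀ {v z} → secondParent g′ z ≡ just v → replaced g′ v ≡ just z
      second-parent⇒replaced′ {v} {z} sp with update-nothing⁻ (secondParent g) sp
      ... | sp′ , z≢y with v ≟ x
      ...   | yes refl = ⊥-elim (z≢y (just-injective (trans (sym (second-parent⇒replaced sp′)) x-replaced-y)))
      ...   | no  _    = second-parent⇒replaced sp′
      lent-parent′ : ∀ {z v w} → secondParent g′ z ≡ just v → w ∈ lent g′ z → parent g′ w ≡ just v ⊎ w ∈ lent g′ v
      lent-parent′ {z} {v} {w} sp w∈ with update-nothing⁻ (secondParent g) sp
      ... | sp′ , z≢y with lent-parent sp′ (subst (w ∈_) (update-≢ [] (lent g) z≢y) w∈)
      ...   | inj₁ w↑v with w ∈? lent g y
      ...     | yes w∈y = ⊥-elim (z≢y (just-injective (trans (sym (second-parent⇒replaced z↑₂x)) x-replaced-y)))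
        where
        -- w would then be lent to x by z as well as by y, but x replaced only y.
        z↑₂x : secondParent g z ≡ just x
        z↑₂x = subst (λ v → secondParent g z ≡ just v) (just-injective (trans (sym w↑v) (lent-y↑x w∈y))) sp′
      ...     | no  _   = inj₁ w↑v
      lent-parent′ {z} {v} {w} sp w∈ | sp′ , z≢y | inj₂ w∈v with v ≟ y
      ...     | yes refl = inj₁ (reparent-∈ w∈v)
      ...     | no  _    = inj₂ w∈v
      lent-path′ : ∀ {z w} → w ∈ lent g′ z → Path (arcs s) z w
      lent-path′ {z} w∈ with z ≟ y
      ... | yes refl = ⊥-elim (∉[] w∈)
      ... | no  _    = lent-path w∈

    invariant : InvariantExcept (_≡ x) s g′
    invariant = record { dag = dag ; node-rank = node-rank ; forest = forest ; seconds = seconds }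

  IsNode-destroy⁻ : ∀ s {x z} → IsNode (destroy x s) z → IsNode s z × z ≢ x
  IsNode-destroy⁻ s {x} nz with find nz
  ... | n , n∈ , refl = let n∈s , n≢x = ∈-filter⁻ (λ n → ¬? (nid n ≟ x)) {xs = nodes s} n∈ in lose n∈s refl , n≢x

  IsNode-destroy⁺ : ∀ s {x z} → IsNode s z → z ≢ x → IsNode (destroy x s) z
  IsNode-destroy⁺ s {x} nz z≢x with find nz
  ... | n , n∈ , refl = lose (∈-filter⁺ (λ n → ¬? (nid n ≟ x)) n∈ z≢x) refl

  arc-destroy⁻ : ∀ s {x p q} → Arc (destroy x s) p q → Arc s p q × p ≢ x
  arc-destroy⁻ s {x} = ∈-filter⁻ (λ a → ¬? (proj₁ a ≟ x)) {xs = arcs s}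

  arc-destroy⁺ : ∀ s {x p q} → Arc s p q → p ≢ x → Arc (destroy x s) p q
  arc-destroy⁺ s {x} = ∈-filter⁺ (λ a → ¬? (proj₁ a ≟ x))

  Path-destroy : ∀ s {x p q} → ¬ HasParent s x → p ≢ x → Path (arcs s) p q → Path (arcs (destroy x s)) p q
  Path-destroy s x-root p≢x [ a ]    = [ arc-destroy⁺ s a p≢x ]
  Path-destroy s x-root p≢x (a ∷ as) =
    arc-destroy⁺ s a p≢x ∷ Path-destroy s x-root (hasParent⇒≢root s x-root (arc-hasParent s a)) as

  orphan : Ghost → ℕ → Ghost
  orphan g x = record g { parent = forget x ∘ parent g }

  module Orphan {s g x} (I : InvariantExcept (_≡ x) s g) (x-root : IsRoot s x)
                (x-replaced-none : replaced g x ≡ nothing) where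
    open InvariantExcept I hiding (dag; forest; seconds)
    open Consequences I

    s′ : State
    s′ = destroy x s

    g′ : Ghost
    g′ = orphan g x

    second-parent≢x : ∀ {z v} → secondParent g z ≡ just v → v ≢ x
    second-parent≢x sp refl with trans (sym (second-parent⇒replaced sp)) x-replaced-none
    ... | ()

    node⁻ : ∀ {z} → IsNode s′ z → IsNode s z
    node⁻ nz = proj₁ (IsNode-destroy⁻ s nz)

    member⁻ : ∀ {n} → n ∈ nodes s′ → n ∈ nodes s
    member⁻ n∈ = proj₁ (∈-filter⁻ (λ n → ¬? (nid n ≟ x)) {xs = nodes s} n∈)

    dag : Dag s′
    dag = record
      { level      = level
      ; arc-source = λ a → let a′ , p≢x = arc-destroy⁻ s a in IsNode-destroy⁺ s (arc-source a′) p≢x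
      ; arc-target = λ a → let a′ , _ = arc-destroy⁻ s a in
                           IsNode-destroy⁺ s (arc-target a′) (hasParent⇒≢root s (proj₂ x-root) (arc-hasParent s a′))
      ; arc-level  = λ a → arc-level (proj₁ (arc-destroy⁻ s a)) }

    forest : VirtualForest (λ _ → ⊥) s′ g′
    forest = record
      { parent-path   = λ {z} z↑ → let z↑′ , p≢x = forget⁻ x (parent g z) z↑ in
                                   Path-destroy s (proj₂ x-root) p≢x (parent-path z↑′)
      ; child-parent  = λ nz _ w∈ → let nz′ , z≢x = IsNode-destroy⁻ s nz in
                                    forget-≢ x (child-parent nz′ z≢x w∈) z≢x
      ; staircase     = staircase ∘ node⁻
      ; top-staircase = top-staircase ∘ node⁻
      ; unique-family = unique-family ∘ node⁻ }

    seconds : SecondParents s′ g′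
    seconds = record
      { lent-none              = lent-none
      ; second-parent-arc      = λ sp → arc-destroy⁺ s (second-parent-arc sp) (second-parent≢x sp)
      ; second-parent-hollow   = second-parent-hollow ∘ member⁻
      ; replaced⇒second-parent = replaced⇒second-parent
      ; second-parent⇒replaced = second-parent⇒replaced
      ; lent-parent            = λ sp w∈ → map₁ (λ w↑ → forget-≢ x w↑ (second-parent≢x sp)) (lent-parent sp w∈)
      ; lent-path              = λ w∈ → Path-destroy s (proj₂ x-root) (lender≢x w∈) (lent-path w∈) }
      where
      lender≢x : ∀ {z w} → w ∈ lent g z → z ≢ x
      lender≢x w∈ refl = ∉[] (subst (_ ∈_) (root-lent (proj₂ x-root)) w∈)

    invariant : Invariant s′ g′
    invariant = record { dag = dag ; node-rank = node-rank ∘ member⁻ ; forest = forest ; seconds = seconds }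

  destroy-invariant : ∀ {s s′ g} → DestroyStep s s′ → Invariant s g → ∃ (Invariant s′)
  destroy-invariant {g = g} (dstep x x-root _) I with replaced g x in x-replaced
  ... | nothing = _ , Orphan.invariant (exempt I) x-root x-replaced
  ... | just y  = _ , Orphan.invariant (Regain.invariant I x-root x-replaced) x-root (update-≡ x nothing (replaced g))

  decrease : Ghost → ℕ → ℕ → ℕ → Ghost
  decrease g u v r = record
    { rankOf       = update v (r ∸ 2) (rankOf g)
    ; parent       = reparent v (drop 2 (children g u)) (parent g)
    ; secondParent = update u (just v) (secondParent g)
    ; replaced     = update v (just u) (replaced g)
    ; children     = update v (drop 2 (children g u)) (update u (take 2 (children g u)) (children g))
    ; lent         = update v [] (update u (drop 2 (children g u)) (lent g)) }

  -- u keeps its two most recent children T and lends the others D to the new node v,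
  -- whose rank r ∸ 2 they support.
  module DecreaseKey {h g u v k₀ r} (I₀ : Invariant h g) (u-full : FullNode h u k₀ r) (v-fresh : Fresh h v)
                     (k : TotalOrder.Carrier O) where
    open MakeHollow u using (IsNode-map⁺; IsNode-map⁻)

    s : State
    s = makeHollow u h

    I : Invariant s g
    I = makeHollow-invariant u I₀

    open InvariantExcept I hiding (dag; forest; seconds)
    open Consequences I

    s₀ : State
    s₀ = addArc v u (s ∪ single v k (r ∸ 2))

    g′ : Ghost
    g′ = decrease g u v r

    D T : List ℕ
    D = drop 2 (children g u)
    T = take 2 (children g u)

    nu : IsNode s u
    nu = IsNode-map⁺ h (lose u-full refl)

    ≢v : ∀ {y} → IsNode s y → y ≢ v
    ≢v ny refl = v-fresh (IsNode-map⁻ h ny)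

    u≢v : u ≢ v
    u≢v = ≢v nu

    node₀ : ∀ {y} → IsNode s y → IsNode s₀ y
    node₀ = Anyₚ.++⁺ˡ

    arc₀ : ∀ {p q} → Arc s p q → Arc s₀ p q
    arc₀ = there ∘ ∈-++⁺ˡ

    node-split : ∀ {y} → IsNode s₀ y → IsNode s y ⊎ y ≡ v
    node-split ny with Anyₚ.++⁻ (nodes s) ny
    ... | inj₁ ny′         = inj₁ ny′
    ... | inj₂ (here v≡y) = inj₂ (sym v≡y)

    u-no-second : secondParent g u ≡ nothing
    u-no-second with secondParent g u in sp
    ... | nothing = refl
    ... | just _  with InvariantExcept.second-parent-hollow I₀ u-full sp
    ...   | ()

    rank-u : rankOf g u ≡ r
    rank-u = sym (InvariantExcept.node-rank I₀ u-full)

    family-u : Family g u ≡ T ++ D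
    family-u = trans (cong (children g u ++_) (lent-none u-no-second)) (trans (++-identityʳ _) (sym (take++drop≡id 2 _)))

    unique-TD : Unique (T ++ D)
    unique-TD = subst Unique family-u (unique-family nu)

    staircase-u : Staircase (rankOf g) r r (children g u)
    staircase-u = subst (λ k → Staircase (rankOf g) k k (children g u)) rank-u
                    (subst (Staircase (rankOf g) _ _) (trans family-u (take++drop≡id 2 _)) (staircase nu))

    T-parent : ∀ {y} → y ∈ T → parent g y ≡ just u
    T-parent y∈ = child-parent nu (λ ()) (subst (_ ∈_) (take++drop≡id 2 _) (∈-++⁺ˡ y∈))

    D-parent : ∀ {y} → y ∈ D → parent g y ≡ just u
    D-parent y∈ = child-parent nu (λ ()) (subst (_ ∈_) (take++drop≡id 2 _) (∈-++⁺ʳ T y∈))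

    D-rank : ∀ {y} → y ∈ D → rankOf g′ y ≡ rankOf g y
    D-rank y∈ = update-≢ _ (rankOf g) (≢v (parent-node (D-parent y∈)))

    family-rank : ∀ {x y} → IsNode s x → y ∈ Family g x → rankOf g′ y ≡ rankOf g y
    family-rank nx y∈ = update-≢ _ (rankOf g) (≢v (family-node nx (λ ()) y∈))

    dag : Dag s₀
    dag = link-dag (u≢v ∘ sym) (Anyₚ.++⁺ʳ (nodes s) (here refl) , v-root) (node₀ nu)
            (union-dag (InvariantExcept.dag I) (arcless-dag _) (λ y ny → λ { (here refl) → ≢v ny refl }))
      where
      v-root : ¬ HasParent (s ∪ single v k (r ∸ 2)) v
      v-root v-child with Anyₚ.++⁻ (arcs s) v-child
      ... | inj₁ v-child-in-s = ≢v (hasParent-node v-child-in-s) refl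
      ... | inj₂ ()

    node-rank′ : ∀ {n} → n ∈ nodes s₀ → rank n ≡ rankOf g′ (nid n)
    node-rank′ n∈ with ∈-++⁻ (nodes s) n∈
    ... | inj₁ n∈s        = trans (node-rank n∈s) (sym (update-≢ _ (rankOf g) (≢v (lose n∈s refl))))
    ... | inj₂ (here refl) = sym (update-≡ v (r ∸ 2) (rankOf g))

    forest : VirtualForest (λ _ → ⊥) s₀ g′
    forest = record
      { parent-path   = parent-path′
      ; child-parent  = λ nz _ → child-parent′ nz
      ; staircase     = staircase′
      ; top-staircase = top-staircase′
      ; unique-family = unique-family′ }
      where
      parent-path′ : ∀ {z p} → parent g′ z ≡ just p → Path (arcs s₀) p z
      parent-path′ {z} z↑ with z ∈? D
      ... | yes z∈D = subst (λ p → Path (arcs s₀) p z) (just-injective z↑)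
                        (here refl ∷ Path-mono arc₀ (parent-path (D-parent z∈D)))
      ... | no  _   = Path-mono arc₀ (parent-path z↑)
      child-parent′ : ∀ {z w} → IsNode s₀ z → w ∈ children g′ z → parent g′ w ≡ just z
      child-parent′ {z} {w} nz w∈ with z ≟ v
      ... | yes refl = reparent-∈ w∈
      ... | no  z≢v with z ≟ u
      ...   | yes refl = trans (reparent-∉ (proj₂ (proj₂ (Unique-++⁻ T unique-TD)) w∈)) (T-parent w∈)
      ...   | no  z≢u with node-split nz
      ...     | inj₂ z≡v = ⊥-elim (z≢v z≡v)
      ...     | inj₁ nz′ = trans (reparent-∉ w∉D) w↑z
        where
        w↑z : parent g w ≡ just z
        w↑z = child-parent nz′ (λ ()) w∈
        w∉D : w ∉ D
        w∉D w∈D = z≢u (just-injective (trans (sym w↑z) (D-parent w∈D)))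
      staircase′ : ∀ {z} → IsNode s₀ z → Staircase (rankOf g′) (rankOf g′ z) (rankOf g′ z) (Family g′ z)
      staircase′ {z} nz with z ≟ v
      ... | yes refl = subst (Staircase _ _ _) (sym (++-identityʳ D))
                         (Staircase-cong _ _ D D-rank (Staircase-drop 2 r (children g u) staircase-u))
      ... | no  z≢v with z ≟ u
      ...   | yes refl = Staircase-cong _ _ (T ++ D) (family-rank nu ∘ subst (_ ∈_) (sym family-u))
                           (subst (Staircase (rankOf g) _ _) family-u (staircase nu))
      ...   | no  _ with node-split nz
      ...     | inj₂ z≡v = ⊥-elim (z≢v z≡v)
      ...     | inj₁ nz′ = Staircase-cong _ _ (Family g z) (family-rank nz′) (staircase nz′)
      top-staircase′ : ∀ {z} → IsNode s₀ z → Staircase (rankOf g′) (rankOf g′ z) (2 ⊓ rankOf g′ z) (children g′ z)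
      top-staircase′ {z} nz with z ≟ v
      ... | yes refl = Staircase-cong _ _ D D-rank
                         (Staircase-weaken D (m⊓n≤n 2 _) (Staircase-drop 2 r (children g u) staircase-u))
      ... | no  z≢v with z ≟ u
      ...   | yes refl = Staircase-cong _ _ T (family-rank nu ∘ subst (_ ∈_) (sym family-u) ∘ ∈-++⁺ˡ)
                           (subst (λ k → Staircase (rankOf g) k (2 ⊓ k) T) (sym rank-u)
                             (Staircase-take 2 r (children g u) staircase-u))
      ...   | no  _ with node-split nz
      ...     | inj₂ z≡v = ⊥-elim (z≢v z≡v)
      ...     | inj₁ nz′ = Staircase-cong _ _ (children g z) (family-rank nz′ ∘ ∈-++⁺ˡ) (top-staircase nz′)
      unique-family′ : ∀ {z} → IsNode s₀ z → Unique (Family g′ z)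
      unique-family′ {z} nz with z ≟ v
      ... | yes refl = subst Unique (sym (++-identityʳ D)) (proj₁ (proj₂ (Unique-++⁻ T unique-TD)))
      ... | no  z≢v with z ≟ u
      ...   | yes refl = unique-TD
      ...   | no  _ with node-split nz
      ...     | inj₂ z≡v = ⊥-elim (z≢v z≡v)
      ...     | inj₁ nz′ = unique-family nz′

    lent′-u : lent g′ u ≡ D
    lent′-u = trans (update-≢ [] _ u≢v) (update-≡ u D (lent g))

    lent′-other : ∀ {z} → z ≢ u → z ≢ v → lent g′ z ≡ lent g z
    lent′-other z≢u z≢v = trans (update-≢ [] _ z≢v) (update-≢ D (lent g) z≢u)

    lent-parent′ : ∀ {z w y} → secondParent g′ z ≡ just w → y ∈ lent g′ z → parent g′ y ≡ just w ⊎ y ∈ lent g′ w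
    lent-parent′ {z} {w} {y} z↑₂w y∈ with z ≟ u
    ... | yes refl = inj₁ (trans (reparent-∈ (subst (y ∈_) lent′-u y∈)) z↑₂w)
    ... | no  z≢u
        with lent-parent z↑₂w (subst (y ∈_) (lent′-other z≢u (≢v (arc-target (second-parent-arc z↑₂w)))) y∈)
    ...   | inj₁ y↑w with y ∈? D
    ...     | yes y∈D = inj₂ (subst (λ w → y ∈ lent g′ w) (just-injective (trans (sym (D-parent y∈D)) y↑w))
                                 (subst (y ∈_) (sym lent′-u) y∈D))
    ...     | no  _   = inj₁ y↑w
    lent-parent′ {z} {w} {y} z↑₂w y∈ | no z≢u | inj₂ y∈w with w ≟ u
    ...     | yes refl = ⊥-elim (∉[] (subst (y ∈_) (lent-none u-no-second) y∈w))
    ...     | no  w≢u  =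
      inj₂ (subst (y ∈_) (sym (lent′-other w≢u (≢v (arc-source (second-parent-arc z↑₂w))))) y∈w)

    seconds : SecondParents s₀ g′
    seconds = record
      { lent-none              = λ {z} → lent-none′ {z}
      ; second-parent-arc      = λ {z} → second-parent-arc′ {z}
      ; second-parent-hollow   = second-parent-hollow′
      ; replaced⇒second-parent = λ {w} {z} → replaced⇒second-parent′ {w} {z}
      ; second-parent⇒replaced = λ {w} {z} → second-parent⇒replaced′ {w} {z}
      ; lent-parent            = λ {z} {w} {y} → lent-parent′ {z} {w} {y}
      ; lent-path              = λ {z} → lent-path′ {z} }
      where
      just≢nothing : ∀ {a : ℕ} → just a ≢ nothing
      just≢nothing ()
      lent-none′ : ∀ {z} → secondParent g′ z ≡ nothing → lent g′ z ≡ []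
      lent-none′ {z} no-sp with z ≟ v
      ... | yes refl = refl
      ... | no  _ with z ≟ u
      ...   | yes refl = ⊥-elim (just≢nothing no-sp)
      ...   | no  _    = lent-none no-sp
      second-parent-arc′ : ∀ {z w} → secondParent g′ z ≡ just w → Arc s₀ w z
      second-parent-arc′ {z} sp with z ≟ u
      ... | yes refl = subst (λ w → Arc s₀ w u) (just-injective sp) (here refl)
      ... | no  _    = arc₀ (second-parent-arc sp)
      second-parent-hollow′ : ∀ {n w} → n ∈ nodes s₀ → secondParent g′ (nid n) ≡ just w → full n ≡ false
      second-parent-hollow′ {n} n∈ sp with ∈-++⁻ (nodes s) n∈
      ... | inj₁ n∈s with nid n ≟ u
      ...   | yes n≡u = makeHollow-hollow h u n∈s n≡u
      ...   | no  _   = second-parent-hollow n∈s sp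
      second-parent-hollow′ {n} n∈ sp | inj₂ (here refl) =
        ⊥-elim (≢v (arc-target (second-parent-arc (trans (sym (update-≢ _ (secondParent g) (u≢v ∘ sym))) sp)))
                   refl)
      replaced⇒second-parent′ : ∀ {w z} → replaced g′ w ≡ just z → secondParent g′ z ≡ just w
      replaced⇒second-parent′ {w} {z} rp with w ≟ v
      ... | yes refl = subst (λ z → secondParent g′ z ≡ just v) (just-injective rp) (update-≡ u (just v) (secondParent g))
      ... | no  _ with z ≟ u
      ...   | yes refl = ⊥-elim (just≢nothing (trans (sym (replaced⇒second-parent rp)) u-no-second))
      ...   | no  _    = replaced⇒second-parent rp
      second-parent⇒replaced′ : ∀ {w z} → secondParent g′ z ≡ just w → replaced g′ w ≡ just z
      second-parent⇒replaced′ {w} {z} sp with z ≟ u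
      ... | yes refl = subst (λ w → replaced g′ w ≡ just u) (just-injective sp) (update-≡ v (just u) (replaced g))
      ... | no  _    = trans (update-≢ _ (replaced g) (≢v (arc-source (second-parent-arc sp)))) (second-parent⇒replaced sp)
      lent-path′ : ∀ {z y} → y ∈ lent g′ z → Path (arcs s₀) z y
      lent-path′ {z} {y} y∈ with z ≟ v
      ... | yes refl = ⊥-elim (∉[] y∈)
      ... | no  z≢v with z ≟ u
      ...   | yes refl = Path-mono arc₀ (parent-path (D-parent y∈))
      ...   | no  z≢u  = Path-mono arc₀ (lent-path y∈)

    invariant : Invariant s₀ g′
    invariant = record { dag = dag ; node-rank = node-rank′ ; forest = forest ; seconds = seconds }

  star-invariant : ∀ {ℓ} {R : State → State → Set ℓ} → (∀ {s s′ g} → R s s′ → Invariant s g → ∃ (Invariant s′)) →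
                   ∀ {s s′ g} → Star R s s′ → Invariant s g → ∃ (Invariant s′)
  star-invariant step ε        I = _ , I
  star-invariant step (r ◅ rs) I = star-invariant step rs (proj₂ (step r I))

  valid⇒invariant : ∀ {h} → Valid h → ∃ (Invariant h)
  valid⇒invariant make-heap = ghost₀ , arcless-invariant [] []
  valid⇒invariant (insert x k valid x-fresh m) =
    meld-invariant m (arcless-invariant _ (refl ∷ [])) (proj₂ (valid⇒invariant valid)) λ { _ (here refl) → x-fresh }
  valid⇒invariant (meld valid₁ valid₂ disjoint m) =
    meld-invariant m (proj₂ (valid⇒invariant valid₁)) (proj₂ (valid⇒invariant valid₂)) disjoint
  valid⇒invariant (decrease-key-root x k _ _ valid _ _ _) =
    _ , setKey-invariant x k (proj₂ (valid⇒invariant valid))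
  valid⇒invariant (decrease-key-nonroot _ _ k _ _ valid u-full _ _ v-fresh link) =
    _ , unrankedLink-invariant link (DecreaseKey.invariant (proj₂ (valid⇒invariant valid)) u-full v-fresh k)
  valid⇒invariant (delete-nonroot u _ _ valid _ _) =
    _ , makeHollow-invariant u (proj₂ (valid⇒invariant valid))
  valid⇒invariant (delete-root u _ _ valid _ _ destroys _ rankedLinks _ unrankedLinks _) =
    let _ , I₁ = star-invariant destroy-invariant destroys (makeHollow-invariant u (proj₂ (valid⇒invariant valid)))
        _ , I₂ = star-invariant rankedLink-invariant rankedLinks I₁
    in star-invariant (λ link I → _ , unrankedLink-invariant link I) unrankedLinks I₂

corollary4p7 : ∀ {c ℓ₁ ℓ₂} (O : TotalOrder c ℓ₁ ℓ₂) → let open HollowHeap O in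
               (h : State) → Valid h →
               ∀ n → n ∈ nodes h → PhiPow≤ (rank n) (length (nodes h))
corollary4p7 O h valid = invariant⇒rank-bound (proj₂ (valid⇒invariant valid))
  where open Invariants O
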